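{- Let $\mathbf{A}\in\{0,1\}^{d\times n}$ and $k\ge 1$. There exist indices $j_1,\dots,j_{2^k-1}\in[n]$ and a bijection $\pi:[2^k-1]\to 2^{[k]}\setminus\{\emptyset\}$ such that the sets $\mathcal{B}_1,\dots,\mathcal{B}_k\subseteq[d]$ produced by the construction below satisfy $\mathrm{Err}(\mathcal{B}_1,\dots,\mathcal{B}_k)\le 2^k\,\mathrm{OPT}_k$. Consequently the Generalized Column Subset Selection procedure, which performs the construction for all such choices and returns the sets of minimum error, outputs $\mathcal{B}_1,\dots,\mathcal{B}_k$ with $\mathrm{Err}(\mathcal{B}_1,\dots,\mathcal{B}_k)\le 2^k\,\mathrm{OPT}_k$.
   Context: Boolean model: the product of binary matrices is over the Boolean semiring, $(\mathbf{U}\mathbf{V})_{ij} = \bigvee_l (u_{il}\wedge v_{lj})$; $\|\mathbf{M}\|_F^2$ is the number of $1$ entries of a binary matrix. $\mathrm{OPT}_k := \min_{\mathbf{U}\in\{0,1\}^{d\times k},\mathbf{V}\in\{0,1\}^{k\times n}}\|\mathbf{A}-\mathbf{U}\mathbf{V}\|_F^2$ (Boolean product). Identify binary vectors in $\{0,1\}^d$ with subsets of $[d]$; let $\mathcal{A}_j\subseteq[d]$ be the $j$th column of $\mathbf{A}$. For sets $\mathcal{B}_1,\dots,\mathcal{B}_k\subseteq[d]$ (the columns of a basis matrix), $\mathrm{Err}(\mathcal{B}_1,\dots,\mathcal{B}_k) := \sum_{j=1}^n \min_{T\subseteq[k]} |\mathcal{A}_j \triangle \bigcup_{i\in T}\mathcal{B}_i|$,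 which equals the minimum over $\mathbf{V}\in\{0,1\}^{k\times n}$ of $\|\mathbf{A}-\mathbf{B}\mathbf{V}\|_F^2$ with $\mathbf{B}$ the matrix of the $\mathcal{B}_i$. Construction: given $j_1,\dots,j_{2^k-1}\in[n]$ (repetitions allowed) and a bijection $\pi$, set $\mathcal{S}_\ell := \pi(\ell)$ and $\mathcal{D}_{\mathcal{S}_\ell} := \mathcal{A}_{j_\ell}$ for $\ell\in[2^k-1]$. For $i\in[k]$, $\ell\in[2^k-1]$ let $\mathcal{E}_i^\ell := \bigcap_{\ell'\ge\ell,\ i\in\mathcal{S}_{\ell'}} \mathcal{D}_{\mathcal{S}_{\ell'}}$ (an empty intersection is $[d]$). For $1\le\ell_1<\ell_2\le 2^k-1$ and $i\in\mathcal{S}_{\ell_1}\cap\mathcal{S}_{\ell_2}$ let $\mathcal{F}_i^{\ell_1,\ell_2} := \mathcal{E}_i^{\ell_1+1}\setminus \bigcup_{i'\in\mathcal{S}_{\ell_2}}\mathcal{E}_{i'}^{\ell_1}$. Finally $\mathcal{B}_i := \mathcal{E}_i^1 \cup \bigcup_{\ell_1<\ell_2:\ i\in\mathcal{S}_{\ell_1}\cap\mathcal{S}_{\ell_2}} \mathcal{F}_i^{\ell_1,\ell_2}$. -}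

module Defs where

open import Data.Nat using (ℕ; zero; suc; _+_; _*_; _∸_; _^_; _≤_; _<_; _≤?_; _<?_; _⊓_)
open import Data.Bool using (Bool; true; false; _∧_; _xor_)
open import Data.Fin using (Fin; toℕ)
open import Data.Fin.Subset using (Subset; inside; outside; _∈_; _∩_; _∪_; _─_; ⋃; ⋂; ∣_∣; ⊥; Nonempty)
open import Data.Fin.Subset.Properties using (_∈?_)
open import Data.List using (List; []; _∷_; _++_; map; filter; foldr; allFin; concatMap)
open import Data.Nat.ListAction using (sum)
import Data.Vec
open Data.Vec using (Vec; tabulate; zipWith)
open import Data.Product using (Σ; _×_; ∃; _,_)
open import Relation.Nullary using (Dec; yes; no)
open import Relation.Nullary.Decidable using (_×-dec_)
open import Relation.Binary.PropositionalEquality using (_≡_)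
open import Function.Definitions using (Injective)

BMat : ℕ → ℕ → Set
BMat m n = Fin m → Fin n → Bool

anyFin : (k : ℕ) → (Fin k → Bool) → Bool
anyFin k f = foldr Data.Bool._∨_ false (map f (allFin k))

_⊙_ : ∀ {d k n} → BMat d k → BMat k n → BMat d n
_⊙_ {k = k} U V r j = anyFin k (λ l → U r l ∧ V l j)

b2n : Bool → ℕ
b2n true = 1
b2n false = 0

-- ‖M − N‖_F² for binary M, N = number of entries where they differ
dist² : ∀ {d n} → BMat d n → BMat d n → ℕ
dist² {d} {n} M N = sum (map (λ r → sum (map (λ j → b2n (M r j xor N r j)) (allFin n))) (allFin d))

col : ∀ {d n} → BMat d n → Fin n → Subset d
col M j = tabulate (λ r → M r j)

_△_ : ∀ {d} → Subset d → Subset d → Subset d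
_△_ = zipWith _xor_

allSubsets : (k : ℕ) → List (Subset k)
allSubsets zero = Data.Vec.[] ∷ []
allSubsets (suc k) = map (outside Data.Vec.∷_) (allSubsets k) ++ map (inside Data.Vec.∷_) (allSubsets k)

unionOver : ∀ {d k} → (Fin k → Subset d) → Subset k → Subset d
unionOver {k = k} B T = ⋃ (map B (filter (λ i → i ∈? T) (allFin k)))

-- minimum of a list of naturals, with a given default (only the value of
-- the empty-subset candidate is used as the default, which is itself in the
-- list, so this is the true minimum)
minList : ℕ → List ℕ → ℕ
minList = foldr _⊓_

Err : ∀ {d n k} → BMat d n → (Fin k → Subset d) → ℕ
Err {d} {n} {k} A B =
  sum (map (λ j → minList ∣ col A j △ unionOver B ⊥ ∣
                          (map (λ T → ∣ col A j △ unionOver B T ∣) (allSubsets k)))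
           (allFin n))

IsBijToNonempty : ∀ {k} → (Fin (2 ^ k ∸ 1) → Subset k) → Set
IsBijToNonempty {k} π =
  Injective _≡_ _≡_ π
  × (∀ ℓ → Nonempty (π ℓ))
  × (∀ (S : Subset k) → Nonempty S → ∃ λ ℓ → π ℓ ≡ S)

-- The construction (indices ℓ are 0-based: Fin (2^k−1); the paper's
-- ℓ ∈ {1,…,2^k−1} corresponds to toℕ ℓ + 1)

module Construction {d n k : ℕ} (A : BMat d n)
                    (j : Fin (2 ^ k ∸ 1) → Fin n)
                    (π : Fin (2 ^ k ∸ 1) → Subset k) where

  m : ℕ
  m = 2 ^ k ∸ 1

  S : Fin m → Subset k
  S = π

  D : Fin m → Subset d
  D ℓ = col A (j ℓ)

  -- E_i^ℓ = ⋂_{ℓ' ≥ ℓ, i ∈ S_ℓ'} D_{S_ℓ'}   (ℓ here is 0-based, as a ℕ;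
  -- the empty intersection is [d])
  E : Fin k → ℕ → Subset d
  E i ℓ = ⋂ (map D (filter (λ ℓ' → (ℓ ≤? toℕ ℓ') ×-dec (i ∈? S ℓ')) (allFin m)))

  F : Fin k → Fin m → Fin m → Subset d
  F i ℓ₁ ℓ₂ = E i (suc (toℕ ℓ₁)) ─ ⋃ (map (λ i' → E i' (toℕ ℓ₁)) (filter (λ i' → i' ∈? S ℓ₂) (allFin k)))

  pairs : Fin k → List (Fin m × Fin m)
  pairs i = filter (λ { (ℓ₁ , ℓ₂) → (toℕ ℓ₁ <? toℕ ℓ₂) ×-dec ((i ∈? S ℓ₁) ×-dec (i ∈? S ℓ₂)) })
                   (concatMap (λ ℓ₁ → map (λ ℓ₂ → (ℓ₁ , ℓ₂)) (allFin m)) (allFin m))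

  B : Fin k → Subset d
  B i = E i 0 ∪ ⋃ (map (λ { (ℓ₁ , ℓ₂) → F i ℓ₁ ℓ₂ }) (pairs i))

constructB : ∀ {d n k} → BMat d n → (Fin (2 ^ k ∸ 1) → Fin n)
           → (Fin (2 ^ k ∸ 1) → Subset k) → Fin k → Subset d
constructB A j π = Construction.B A j π

module Submission where

-- Fix an optimal solution: centers U_1..U_k ⊆ [d] and coefficient sets T_j ⊆ [k] whose
-- cost Σ_j |A_j △ ⋃_{i∈T_j} U_i| is OPT_k. Number the nonempty S ⊆ [k] as S_1..S_{2^k−1}
-- by increasing load (the number of j with T_j = S) and take as representative of S_ℓ a
-- column of A closest to its center ⋃_{i∈S_ℓ} U_i, at cost Δ_ℓ. The stability lemma
-- (RowAnalysis) works one row at a time: if every representative from position ℓ on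
-- agrees with its center at row r, then so does ⋃_{i∈S_ℓ} B_i. Summing over rows, a column
-- with T_j = S_ℓ costs at most its share of OPT plus Σ_{ℓ′ ≥ ℓ} Δ_ℓ′ (ColumnAnalysis), and a
-- charging argument based on the sorted loads bounds the extra by (2^k − 1) · OPT.

open import Defs
open import Data.Nat using (ℕ; _*_; _^_; _∸_; _≤_)
open import Data.Fin using (Fin)
open import Data.Fin.Subset using (Subset)
open import Data.Product using (Σ; _×_; ∃; ∃-syntax; _,_)

open import Data.Nat using (zero; suc; _+_; _<_; _≤?_; z≤n; s≤s; pred; >-nonZero)
open import Data.Nat.Properties
open import Data.Bool using (Bool; true; false; not; _∧_; _∨_; _xor_)
open import Data.Bool.Properties using (∨-zeroʳ; ∧-zeroʳ; ∧-identityʳ; ∧-comm; xor-same)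
import Data.Bool as Bool
open import Data.Fin using (zero; suc; toℕ; fromℕ<)
import Data.Fin.Properties as Fin
open import Data.Fin.Subset using (_∈_; _∪_; _∩_; _─_; ⋃; ⋂; ⊥; ∣_∣; Nonempty)
open import Data.Fin.Subset.Properties using (_∈?_; nonempty?; Empty-unique)
open import Data.Fin.Permutation using (Permutation; _⟨$⟩ʳ_; _⟨$⟩ˡ_; inverseˡ; inverseʳ; lift₀; transpose; _∘ₚ_)
import Data.Fin.Permutation as Perm
open import Data.List using (List; []; _∷_; map; filter; foldr; allFin; concatMap)
import Data.List as List
open import Data.List.Properties using (map-tabulate; map-cong)
import Data.List.Membership.Propositional as L
open import Data.List.Membership.Propositional.Properties
  using (∈-map⁺; ∈-++⁺ˡ; ∈-++⁺ʳ; ∈-allFin; ∈-concatMap⁺)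
open import Data.List.Relation.Unary.Any using (here; there)
open import Data.Vec using ([]; _∷_; lookup)
import Data.Vec as Vec
open import Data.Vec.Properties
  using (lookup-zipWith; lookup∘tabulate; lookup-replicate; []=⇒lookup; lookup⇒[]=; ≡-dec)
open import Data.Product using (proj₁; proj₂)
open import Data.Sum using (_⊎_; inj₁; inj₂)
open import Relation.Nullary using (¬_; Dec; yes; no; contradiction)
open import Relation.Nullary.Decidable using (_×-dec_)
open import Relation.Unary using (Pred; Decidable)
open import Relation.Binary.PropositionalEquality
open import Function using (_∘_; id)
import Data.Nat.ListAction as ListAction
open import Algebra.Properties.Semiring.Sum +-*-semiring
  using (sum; sum-syntax; sum-cong-≗; ∑-comm; ∑-distrib-+; *-distribˡ-sum; *-distribʳ-sum)

sum-allFin : ∀ n (f : Fin n → ℕ) → ListAction.sum (map f (allFin n)) ≡ ∑[ i < n ] f i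
sum-allFin n f = trans (cong ListAction.sum (map-tabulate id f)) (sum-tabulate n f)
  where
  sum-tabulate : ∀ n (f : Fin n → ℕ) → ListAction.sum (List.tabulate f) ≡ sum f
  sum-tabulate zero    f = refl
  sum-tabulate (suc n) f = cong (f zero +_) (sum-tabulate n (f ∘ suc))

∑-mono : ∀ {n} {f g : Fin n → ℕ} → (∀ i → f i ≤ g i) → sum f ≤ sum g
∑-mono {zero}  f≤g = z≤n
∑-mono {suc n} f≤g = +-mono-≤ (f≤g zero) (∑-mono (f≤g ∘ suc))

term≤∑ : ∀ {n} (f : Fin n → ℕ) i → f i ≤ sum f
term≤∑ f zero    = m≤m+n (f zero) _
term≤∑ f (suc i) = ≤-trans (term≤∑ (f ∘ suc) i) (m≤n+m _ (f zero))

∑-const : ∀ n c → ∑[ i < n ] c ≡ n * c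
∑-const zero    c = refl
∑-const (suc n) c = cong (c +_) (∑-const n c)

∑≤1 : ∀ {n} (f : Fin n → ℕ) → (∀ i → f i ≤ 1) →
      (∀ i i′ → 1 ≤ f i → 1 ≤ f i′ → i ≡ i′) → sum f ≤ 1
∑≤1 {zero}  f f≤1 unique = z≤n
∑≤1 {suc n} f f≤1 unique with f zero ≟ 0
... | yes f₀≡0 = subst (λ x → x + sum (f ∘ suc) ≤ 1) (sym f₀≡0)
                   (∑≤1 (f ∘ suc) (f≤1 ∘ suc) (λ i i′ p q → Fin.suc-injective (unique _ _ p q)))
... | no  f₀≢0 = begin
    f zero + sum (f ∘ suc)       ≡⟨ cong (f zero +_) (sum-cong-≗ rest≡0) ⟩
    f zero + ∑[ i < n ] 0         ≡⟨ cong (f zero +_) (∑-const n 0) ⟩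
    f zero + n * 0                ≡⟨ cong (f zero +_) (*-zeroʳ n) ⟩
    f zero + 0                    ≡⟨ +-identityʳ (f zero) ⟩
    f zero                        ≤⟨ f≤1 zero ⟩
    1                             ∎
  where
  open ≤-Reasoning
  rest≡0 : ∀ i → f (suc i) ≡ 0
  rest≡0 i with f (suc i) ≟ 0
  ... | yes p = p
  ... | no  p with () ← unique zero (suc i) (n≢0⇒n>0 f₀≢0) (n≢0⇒n>0 p)

_≟ₛ_ : ∀ {k} (S S′ : Subset k) → Dec (S ≡ S′)
_≟ₛ_ = ≡-dec Bool._≟_

⟦_⟧ : ∀ {P : Set} → Dec P → ℕ
⟦ yes _ ⟧ = 1
⟦ no  _ ⟧ = 0

⟦⟧≤1 : ∀ {P : Set} (P? : Dec P) → ⟦ P? ⟧ ≤ 1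
⟦⟧≤1 (yes _) = s≤s z≤n
⟦⟧≤1 (no  _) = z≤n

⟦⟧-yes : ∀ {P : Set} (P? : Dec P) → P → ⟦ P? ⟧ ≡ 1
⟦⟧-yes (yes _) _ = refl
⟦⟧-yes (no ¬p) p = contradiction p ¬p

⟦⟧-pos : ∀ {P : Set} (P? : Dec P) → 1 ≤ ⟦ P? ⟧ → P
⟦⟧-pos (yes p) _ = p

∨-true⁻ : ∀ {a b} → a ∨ b ≡ true → a ≡ true ⊎ b ≡ true
∨-true⁻ {true}  _ = inj₁ refl
∨-true⁻ {false} e = inj₂ e

∧-true⁻ : ∀ {a b} → a ∧ b ≡ true → a ≡ true × b ≡ true
∧-true⁻ {true} {true} _ = refl , refl

true≢false : ∀ {b} → b ≡ true → ¬ b ≡ false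
true≢false refl ()

∧-not-true⁻ : ∀ {a b} → a ∧ not b ≡ true → a ≡ true × b ≡ false
∧-not-true⁻ {true} {false} _ = refl , refl

¬true⇒false : ∀ {b} → ¬ (b ≡ true) → b ≡ false
¬true⇒false {true}  ¬t = contradiction refl ¬t
¬true⇒false {false} _  = refl

lookup-∪ : ∀ {d} (p q : Subset d) r → lookup (p ∪ q) r ≡ lookup p r ∨ lookup q r
lookup-∪ p q r = lookup-zipWith _∨_ r p q

lookup-∩ : ∀ {d} (p q : Subset d) r → lookup (p ∩ q) r ≡ lookup p r ∧ lookup q r
lookup-∩ p q r = lookup-zipWith _∧_ r p q

lookup-△ : ∀ {d} (p q : Subset d) r → lookup (p △ q) r ≡ lookup p r xor lookup q r
lookup-△ p q r = lookup-zipWith _xor_ r p q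

lookup-─ : ∀ {d} (p q : Subset d) r → lookup (p ─ q) r ≡ lookup p r ∧ not (lookup q r)
lookup-─ (x ∷ p) (true  ∷ q) zero    = sym (∧-zeroʳ x)
lookup-─ (x ∷ p) (false ∷ q) zero    = sym (∧-identityʳ x)
lookup-─ (_ ∷ p) (_     ∷ q) (suc r) = lookup-─ p q r

lookup-col : ∀ {d n} (M : BMat d n) j r → lookup (col M j) r ≡ M r j
lookup-col M j r = lookup∘tabulate (λ r → M r j) r

∣∣≡∑ : ∀ {d} (p : Subset d) → ∣ p ∣ ≡ ∑[ r < d ] b2n (lookup p r)
∣∣≡∑ []          = refl
∣∣≡∑ (true  ∷ p) = cong suc (∣∣≡∑ p)
∣∣≡∑ (false ∷ p) = ∣∣≡∑ p

module FilteredFamily {d} {X : Set} {p} {P : Pred X p} (P? : Decidable P) (D : X → Subset d) (r : Fin d) where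

  ⋃-true⁺ : ∀ {x} xs → x L.∈ xs → P x → lookup (D x) r ≡ true →
            lookup (⋃ (map D (filter P? xs))) r ≡ true
  ⋃-true⁺ (y ∷ xs) x∈ px Dx with P? y | x∈
  ... | yes _ | here refl = trans (lookup-∪ (D y) _ r) (cong (_∨ _) Dx)
  ... | no ¬p | here refl = contradiction px ¬p
  ... | yes _ | there x∈′ = trans (lookup-∪ (D y) _ r)
                              (trans (cong (_ ∨_) (⋃-true⁺ xs x∈′ px Dx)) (∨-zeroʳ _))
  ... | no  _ | there x∈′ = ⋃-true⁺ xs x∈′ px Dx

  ⋃-true⁻ : ∀ xs → lookup (⋃ (map D (filter P? xs))) r ≡ true →
            ∃ λ x → P x × lookup (D x) r ≡ true
  ⋃-true⁻ [] e = contradiction (trans (sym e) (lookup-replicate r false)) λ ()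
  ⋃-true⁻ (y ∷ xs) e with P? y
  ... | no  _ = ⋃-true⁻ xs e
  ... | yes py with ∨-true⁻ (trans (sym (lookup-∪ (D y) _ r)) e)
  ...   | inj₁ Dy   = y , py , Dy
  ...   | inj₂ rest = ⋃-true⁻ xs rest

  ⋂-true⁺ : ∀ xs → (∀ x → P x → lookup (D x) r ≡ true) →
            lookup (⋂ (map D (filter P? xs))) r ≡ true
  ⋂-true⁺ [] h = lookup-replicate r true
  ⋂-true⁺ (y ∷ xs) h with P? y
  ... | no  _  = ⋂-true⁺ xs h
  ... | yes py = trans (lookup-∩ (D y) _ r) (cong₂ _∧_ (h y py) (⋂-true⁺ xs h))

  ⋂-true⁻ : ∀ {x} xs → lookup (⋂ (map D (filter P? xs))) r ≡ true →
            x L.∈ xs → P x → lookup (D x) r ≡ true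
  ⋂-true⁻ (y ∷ xs) e x∈ px with P? y | x∈
  ... | yes _ | here refl = proj₁ (∧-true⁻ (trans (sym (lookup-∩ (D y) _ r)) e))
  ... | no ¬p | here refl = contradiction px ¬p
  ... | yes _ | there x∈′ = ⋂-true⁻ xs (proj₂ (∧-true⁻ (trans (sym (lookup-∩ (D y) _ r)) e))) x∈′ px
  ... | no  _ | there x∈′ = ⋂-true⁻ xs e x∈′ px

  ⋂-false⁻ : ∀ xs → lookup (⋂ (map D (filter P? xs))) r ≡ false →
             ∃ λ x → P x × lookup (D x) r ≡ false
  ⋂-false⁻ [] e = contradiction (trans (sym e) (lookup-replicate r true)) λ ()
  ⋂-false⁻ (y ∷ xs) e with P? y
  ... | no  _ = ⋂-false⁻ xs e
  ... | yes py with lookup (D y) r in Dy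
  ...   | false = y , py , Dy
  ...   | true  = ⋂-false⁻ xs (trans (sym (cong (_∧ _) Dy)) (trans (sym (lookup-∩ (D y) _ r)) e))

module _ {d k} (B : Fin k → Subset d) (T : Subset k) (r : Fin d) where
  open FilteredFamily (_∈? T) B r

  unionOver-true⁺ : ∀ {i} → i ∈ T → lookup (B i) r ≡ true → lookup (unionOver B T) r ≡ true
  unionOver-true⁺ i∈T = ⋃-true⁺ (allFin k) (∈-allFin _) i∈T

  unionOver-true⁻ : lookup (unionOver B T) r ≡ true → ∃ λ i → i ∈ T × lookup (B i) r ≡ true
  unionOver-true⁻ = ⋃-true⁻ (allFin k)

  unionOver-false⁺ : (∀ i → i ∈ T → lookup (B i) r ≡ false) → lookup (unionOver B T) r ≡ false
  unionOver-false⁺ h = ¬true⇒false λ e → let (i , i∈T , Bi) = unionOver-true⁻ e in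
                                          true≢false Bi (h i i∈T)

  unionOver-bit : lookup (unionOver B T) r ≡ anyFin k (λ i → lookup T i ∧ lookup (B i) r)
  unionOver-bit = go (allFin k)
    where
    go : ∀ xs → lookup (⋃ (map B (filter (_∈? T) xs))) r
                ≡ foldr _∨_ false (map (λ i → lookup T i ∧ lookup (B i) r) xs)
    go []       = lookup-replicate r false
    go (i ∷ xs) with i ∈? T
    ... | yes i∈T rewrite []=⇒lookup i∈T = trans (lookup-∪ (B i) _ r) (cong (_ ∨_) (go xs))
    ... | no  i∉T rewrite ¬true⇒false (i∉T ∘ lookup⇒[]= i T) = go xs

unionOver-cong : ∀ {d k} {B B′ : Fin k → Subset d} → (∀ i → B i ≡ B′ i) →
                 ∀ T → unionOver B T ≡ unionOver B′ T
unionOver-cong {k = k} B≡B′ T = cong ⋃ (map-cong B≡B′ (filter (_∈? T) (allFin k)))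

⊙-unionOver : ∀ {d k n} (U : BMat d k) (V : BMat k n) r j →
              (U ⊙ V) r j ≡ lookup (unionOver (col U) (col V j)) r
⊙-unionOver {k = k} U V r j = sym (trans (unionOver-bit (col U) (col V j) r)
  (cong (foldr _∨_ false) (map-cong entry (allFin k))))
  where
  entry : ∀ l → lookup (col V j) l ∧ lookup (col U l) r ≡ U r l ∧ V l j
  entry l = trans (cong₂ _∧_ (lookup-col V j l) (lookup-col U l r)) (∧-comm (V l j) (U r l))

dist : ∀ {d} → Subset d → Subset d → ℕ
dist {d} X Y = ∑[ r < d ] b2n (lookup X r xor lookup Y r)

∣△∣≡dist : ∀ {d} (X Y : Subset d) → ∣ X △ Y ∣ ≡ dist X Y
∣△∣≡dist X Y = trans (∣∣≡∑ (X △ Y)) (sum-cong-≗ λ r → cong b2n (lookup-△ X Y r))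

dist-triangle : ∀ {d} (X Y Z : Subset d) → dist X Z ≤ dist X Y + dist Y Z
dist-triangle {d} X Y Z = ≤-trans (∑-mono λ r → triangle (lookup X r) (lookup Y r) (lookup Z r))
                              (≤-reflexive (∑-distrib-+ (bits X Y) (bits Y Z)))
  where
  bits : Subset d → Subset d → Fin d → ℕ
  bits P Q r = b2n (lookup P r xor lookup Q r)
  triangle : ∀ a b c → b2n (a xor c) ≤ b2n (a xor b) + b2n (b xor c)
  triangle true  true  c     = m≤n+m _ 0
  triangle true  false true  = z≤n
  triangle true  false false = s≤s z≤n
  triangle false true  true  = s≤s z≤n
  triangle false true  false = z≤n
  triangle false false c     = ≤-refl

allSubsets-complete : ∀ k (T : Subset k) → T L.∈ allSubsets k
allSubsets-complete zero    []          = here refl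
allSubsets-complete (suc k) (false ∷ T) = ∈-++⁺ˡ (∈-map⁺ _ (allSubsets-complete k T))
allSubsets-complete (suc k) (true  ∷ T) = ∈-++⁺ʳ _ (∈-map⁺ _ (allSubsets-complete k T))

minList≤ : ∀ x₀ (xs : List ℕ) {y} → y L.∈ xs → minList x₀ xs ≤ y
minList≤ x₀ (x ∷ xs) (here refl) = m⊓n≤m x _
minList≤ x₀ (x ∷ xs) (there y∈) = ≤-trans (m⊓n≤n x _) (minList≤ x₀ xs y∈)

Cost : ∀ {d n k} → BMat d n → (Fin k → Subset d) → (Fin n → Subset k) → ℕ
Cost {n = n} A U T = ∑[ j < n ] dist (col A j) (unionOver U (T j))

Cost-cong : ∀ {d n k} (A : BMat d n) {U U′ : Fin k → Subset d} {T T′ : Fin n → Subset k} →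
            (∀ i → U i ≡ U′ i) → (∀ j → T j ≡ T′ j) → Cost A U T ≡ Cost A U′ T′
Cost-cong A {U′ = U′} U≡U′ T≡T′ = sum-cong-≗ λ j →
  cong (dist (col A j)) (trans (unionOver-cong U≡U′ _) (cong (unionOver U′) (T≡T′ j)))

Err≤ : ∀ {d n k} (A : BMat d n) (B : Fin k → Subset d) (T : Fin n → Subset k) →
       Err A B ≤ Cost A B T
Err≤ {n = n} {k} A B T = begin
  Err A B                                                    ≡⟨ sum-allFin n _ ⟩
  ∑[ j < n ] minList _ (map (cost j) (allSubsets k))         ≤⟨ ∑-mono column≤ ⟩
  ∑[ j < n ] cost j (T j)                                    ≡⟨ sum-cong-≗ (λ j → ∣△∣≡dist (col A j) (unionOver B (T j))) ⟩
  ∑[ j < n ] dist (col A j) (unionOver B (T j))              ∎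
  where
  open ≤-Reasoning
  cost : Fin n → Subset k → ℕ
  cost j T′ = ∣ col A j △ unionOver B T′ ∣
  column≤ : ∀ j → minList _ (map (cost j) (allSubsets k)) ≤ cost j (T j)
  column≤ j = minList≤ _ _ (∈-map⁺ (cost j) (allSubsets-complete k (T j)))

dist²-⊙ : ∀ {d n k} (A : BMat d n) (U : BMat d k) (V : BMat k n) →
          dist² A (U ⊙ V) ≡ Cost A (col U) (col V)
dist²-⊙ {d} {n} A U V = begin
  dist² A (U ⊙ V)                                         ≡⟨ sum-allFin d _ ⟩
  ∑[ r < d ] ListAction.sum (map (entry r) (allFin n))   ≡⟨ sum-cong-≗ (λ r → sum-allFin n (entry r)) ⟩
  ∑[ r < d ] ∑[ j < n ] entry r j                         ≡⟨ ∑-comm entry ⟩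
  ∑[ j < n ] ∑[ r < d ] entry r j                         ≡⟨ sum-cong-≗ (λ j → sum-cong-≗ (λ r →
                                                               cong b2n (cong₂ _xor_ (sym (lookup-col A j r))
                                                                                    (⊙-unionOver U V r j)))) ⟩
  ∑[ j < n ] dist (col A j) (unionOver (col U) (col V j)) ∎
  where
  open ≡-Reasoning
  entry : Fin d → Fin n → ℕ
  entry r j = b2n (A r j xor (U ⊙ V) r j)

descend : ∀ {p} {P : Pred ℕ p} → Decidable P → ∀ {x} → P x →
          ∃ λ y → y ≤ x × P y × (∀ {y′} → y ≡ suc y′ → ¬ P y′)
descend P? {zero}  px = zero , z≤n , px , λ ()
descend P? {suc x} px with P? x
... | no ¬px = suc x , ≤-refl , px , λ { refl → ¬px }
... | yes px′ with descend P? px′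
...   | y , y≤x , py , lowest = y , m≤n⇒m≤1+n y≤x , py , lowest

module RowAnalysis {d n k} (A : BMat d n) (j : Fin (2 ^ k ∸ 1) → Fin n)
                   (π : Fin (2 ^ k ∸ 1) → Subset k) (U : Fin k → Subset d) (r : Fin d) where
  open Construction A j π

  bit : Subset d → Bool
  bit X = lookup X r

  module _ (i : Fin k) (x : ℕ) where
    open FilteredFamily (λ ℓ → (x ≤? toℕ ℓ) ×-dec (i ∈? S ℓ)) D r

    E-true⁺ : (∀ ℓ → x ≤ toℕ ℓ → i ∈ S ℓ → bit (D ℓ) ≡ true) → bit (E i x) ≡ true
    E-true⁺ h = ⋂-true⁺ (allFin m) λ ℓ (x≤ℓ , i∈S) → h ℓ x≤ℓ i∈S

    E-true⁻ : bit (E i x) ≡ true → ∀ ℓ → x ≤ toℕ ℓ → i ∈ S ℓ → bit (D ℓ) ≡ true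
    E-true⁻ e ℓ x≤ℓ i∈S = ⋂-true⁻ (allFin m) e (∈-allFin ℓ) (x≤ℓ , i∈S)

    E-false⁻ : bit (E i x) ≡ false → ∃ λ ℓ → x ≤ toℕ ℓ × i ∈ S ℓ × bit (D ℓ) ≡ false
    E-false⁻ e with ⋂-false⁻ (allFin m) e
    ... | ℓ , (x≤ℓ , i∈S) , Dℓ = ℓ , x≤ℓ , i∈S , Dℓ

  entry-position : ∀ i y → bit (E i (suc y)) ≡ true → bit (E i y) ≡ false →
                   ∃ λ ℓ → toℕ ℓ ≡ y × i ∈ S ℓ
  entry-position i y in-after not-at with E-false⁻ i y not-at
  ... | ℓ , y≤ℓ , i∈S , Dℓ with suc y ≤? toℕ ℓ
  ...   | yes y<ℓ = contradiction Dℓ (true≢false (E-true⁻ i (suc y) in-after ℓ y<ℓ i∈S))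
  ...   | no  y≮ℓ = ℓ , ≤-antisym (≤-pred (≰⇒> y≮ℓ)) y≤ℓ , i∈S

  F-true⁺ : ∀ i ℓ₁ ℓ₂ → bit (E i (suc (toℕ ℓ₁))) ≡ true →
            (∀ i′ → i′ ∈ S ℓ₂ → bit (E i′ (toℕ ℓ₁)) ≡ false) → bit (F i ℓ₁ ℓ₂) ≡ true
  F-true⁺ i ℓ₁ ℓ₂ e h = trans (lookup-─ (E i (suc (toℕ ℓ₁))) (unionOver (λ i′ → E i′ (toℕ ℓ₁)) (S ℓ₂)) r)
    (cong₂ (λ a b → a ∧ not b) e (unionOver-false⁺ (λ i′ → E i′ (toℕ ℓ₁)) (S ℓ₂) r h))

  F-true⁻ : ∀ i ℓ₁ ℓ₂ → bit (F i ℓ₁ ℓ₂) ≡ true →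
            bit (E i (suc (toℕ ℓ₁))) ≡ true × (∀ i′ → i′ ∈ S ℓ₂ → ¬ bit (E i′ (toℕ ℓ₁)) ≡ true)
  F-true⁻ i ℓ₁ ℓ₂ e with ∧-not-true⁻ (trans (sym (lookup-─ (E i (suc (toℕ ℓ₁))) (unionOver (λ i′ → E i′ (toℕ ℓ₁)) (S ℓ₂)) r)) e)
  ... | Ei , none = Ei , λ i′ i′∈S E′ →
          true≢false (unionOver-true⁺ (λ i′ → E i′ (toℕ ℓ₁)) (S ℓ₂) r i′∈S E′) none

  Pair : Fin k → Fin m → Fin m → Set
  Pair i ℓ₁ ℓ₂ = toℕ ℓ₁ < toℕ ℓ₂ × i ∈ S ℓ₁ × i ∈ S ℓ₂

  allPairs : List (Fin m × Fin m)
  allPairs = concatMap (λ a → map (a ,_) (allFin m)) (allFin m)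

  -- B_i bit by bit. The construction writes the family (ℓ₁, ℓ₂) ↦ F_i^{ℓ₁,ℓ₂} as a pattern
  -- lambda, so we argue for any family G that agrees with it.
  module _ (i : Fin k) (G : Fin m × Fin m → Subset d) (G≡F : ∀ a b → G (a , b) ≡ F i a b) where

    B′-from-E : bit (E i 0) ≡ true → bit (E i 0 ∪ ⋃ (map G (pairs i))) ≡ true
    B′-from-E e = trans (lookup-∪ (E i 0) (⋃ (map G (pairs i))) r) (cong (_∨ bit (⋃ (map G (pairs i)))) e)

    B′-from-F : ∀ ℓ₁ ℓ₂ → Pair i ℓ₁ ℓ₂ → bit (F i ℓ₁ ℓ₂) ≡ true →
                bit (E i 0 ∪ ⋃ (map G (pairs i))) ≡ true
    B′-from-F ℓ₁ ℓ₂ pair e = trans (lookup-∪ (E i 0) (⋃ (map G (pairs i))) r)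
      (trans (cong (_ ∨_) (FilteredFamily.⋃-true⁺ _ G r allPairs ∈allPairs pair G-bit)) (∨-zeroʳ _))
      where
      G-bit : bit (G (ℓ₁ , ℓ₂)) ≡ true
      G-bit = trans (cong bit (G≡F ℓ₁ ℓ₂)) e
      ∈allPairs : (ℓ₁ , ℓ₂) L.∈ allPairs
      ∈allPairs = ∈-concatMap⁺ _ (L.lose (∈-allFin ℓ₁) (∈-map⁺ (ℓ₁ ,_) (∈-allFin ℓ₂)))

    B′-true⁻ : bit (E i 0 ∪ ⋃ (map G (pairs i))) ≡ true →
               bit (E i 0) ≡ true ⊎ ∃ λ ℓ₁ → ∃ λ ℓ₂ → Pair i ℓ₁ ℓ₂ × bit (F i ℓ₁ ℓ₂) ≡ true
    B′-true⁻ e with ∨-true⁻ (trans (sym (lookup-∪ (E i 0) (⋃ (map G (pairs i))) r)) e)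
    ... | inj₁ E0 = inj₁ E0
    ... | inj₂ inF with FilteredFamily.⋃-true⁻ _ G r allPairs inF
    ...   | (ℓ₁ , ℓ₂) , pair , Gi = inj₂ (ℓ₁ , ℓ₂ , pair , trans (sym (cong bit (G≡F ℓ₁ ℓ₂))) Gi)

  B-from-E : ∀ i → bit (E i 0) ≡ true → bit (B i) ≡ true
  B-from-E i = B′-from-E i _ (λ _ _ → refl)

  B-from-F : ∀ i ℓ₁ ℓ₂ → Pair i ℓ₁ ℓ₂ → bit (F i ℓ₁ ℓ₂) ≡ true → bit (B i) ≡ true
  B-from-F i = B′-from-F i _ (λ _ _ → refl)

  B-true⁻ : ∀ i → bit (B i) ≡ true →
            bit (E i 0) ≡ true ⊎ ∃ λ ℓ₁ → ∃ λ ℓ₂ → Pair i ℓ₁ ℓ₂ × bit (F i ℓ₁ ℓ₂) ≡ true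
  B-true⁻ i = B′-true⁻ i _ (λ _ _ → refl)

  AgreeFrom : ℕ → Set
  AgreeFrom x = ∀ ℓ → x ≤ toℕ ℓ → bit (D ℓ) ≡ bit (unionOver U (S ℓ))

  E-from-center : ∀ {x} → AgreeFrom x → ∀ i → bit (U i) ≡ true → bit (E i x) ≡ true
  E-from-center agree i Ui = E-true⁺ i _ λ ℓ x≤ℓ i∈S →
    trans (agree ℓ x≤ℓ) (unionOver-true⁺ U (S ℓ) r i∈S Ui)

  -- Row r is in the center of S_ℓ: look for the least position y at which some E_i^y
  -- (i ∈ S_ℓ) contains r; either y = 0 and r ∈ E_i^0 ⊆ B_i, or r ∈ F_i^{y,ℓ} ⊆ B_i.
  stability-true : ∀ ℓ → AgreeFrom (toℕ ℓ) → bit (unionOver U (S ℓ)) ≡ true →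
                   bit (unionOver B (S ℓ)) ≡ true
  stability-true ℓ agree center with unionOver-true⁻ U (S ℓ) r center
  ... | i₀ , i₀∈S , Ui₀ with descend Covered? {toℕ ℓ} (i₀ , i₀∈S , E-from-center agree i₀ Ui₀)
    where
    Covered? : Decidable (λ y → ∃ λ i → i ∈ S ℓ × bit (E i y) ≡ true)
    Covered? y = Fin.any? λ i → (i ∈? S ℓ) ×-dec (bit (E i y) Bool.≟ true)
  ...   | zero , _ , (i , i∈S , Ei) , _ = unionOver-true⁺ B (S ℓ) r i∈S (B-from-E i Ei)
  ...   | suc y , y<ℓ , (i , i∈S , Ei) , lowest
          with entry-position i y Ei (¬true⇒false λ e → lowest refl (i , i∈S , e))
  ...     | ℓ₁ , refl , i∈S₁ = unionOver-true⁺ B (S ℓ) r i∈S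
            (B-from-F i ℓ₁ ℓ (y<ℓ , i∈S₁ , i∈S)
              (F-true⁺ i ℓ₁ ℓ Ei λ i′ i′∈S → ¬true⇒false λ e → lowest refl (i′ , i′∈S , e)))

  -- Row r is not in the center of S_ℓ, hence not in D_ℓ; no B_i with i ∈ S_ℓ can contain
  -- r, since E_i^0 ⊆ D_ℓ, and an F_i^{ℓ₁,ℓ₂} containing r would force, by agreement
  -- at ℓ₂, some E_{i′}^{ℓ₁} (i′ ∈ S_ℓ₂) to contain r as well.
  stability-false : ∀ ℓ → AgreeFrom (toℕ ℓ) → bit (unionOver U (S ℓ)) ≡ false →
                    bit (unionOver B (S ℓ)) ≡ false
  stability-false ℓ agree center = unionOver-false⁺ B (S ℓ) r λ i i∈S → ¬true⇒false (B-misses i i∈S)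
    where
    Dℓ : bit (D ℓ) ≡ false
    Dℓ = trans (agree ℓ ≤-refl) center
    B-misses : ∀ i → i ∈ S ℓ → ¬ bit (B i) ≡ true
    B-misses i i∈S Bi with B-true⁻ i Bi
    ... | inj₁ E0 = true≢false (E-true⁻ i 0 E0 ℓ z≤n i∈S) Dℓ
    ... | inj₂ (ℓ₁ , ℓ₂ , (ℓ₁<ℓ₂ , _ , i∈S₂) , Fi) with F-true⁻ i ℓ₁ ℓ₂ Fi
    ...   | Ei , none with suc (toℕ ℓ₁) ≤? toℕ ℓ
    ...     | yes ℓ₁<ℓ = true≢false (E-true⁻ i _ Ei ℓ ℓ₁<ℓ i∈S) Dℓ
    ...     | no  ℓ₁≮ℓ with unionOver-true⁻ U (S ℓ₂) r
                              (trans (sym (agree ℓ₂ (≤-trans ℓ≤ℓ₁ (<⇒≤ ℓ₁<ℓ₂))))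
                                     (E-true⁻ i _ Ei ℓ₂ ℓ₁<ℓ₂ i∈S₂))
      where ℓ≤ℓ₁ = ≤-pred (≰⇒> ℓ₁≮ℓ)
    ...       | i′ , i′∈S₂ , Ui′ = none i′ i′∈S₂
                  (E-from-center (λ ℓ′ le → agree ℓ′ (≤-trans ℓ≤ℓ₁ le)) i′ Ui′)
      where ℓ≤ℓ₁ = ≤-pred (≰⇒> ℓ₁≮ℓ)

  stability : ∀ ℓ → AgreeFrom (toℕ ℓ) → bit (unionOver B (S ℓ)) ≡ bit (unionOver U (S ℓ))
  stability ℓ agree with bit (unionOver U (S ℓ)) in center
  ... | true  = stability-true  ℓ agree center
  ... | false = stability-false ℓ agree center

b2n≤1 : ∀ b → b2n b ≤ 1
b2n≤1 true  = ≤-refl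
b2n≤1 false = z≤n

b2n-xor≡0 : ∀ {a b} → b2n (a xor b) ≡ 0 → a ≡ b
b2n-xor≡0 {true}  {true}  _ = refl
b2n-xor≡0 {false} {false} _ = refl

module ColumnAnalysis {d n k} (A : BMat d n) (j : Fin (2 ^ k ∸ 1) → Fin n)
                      (π : Fin (2 ^ k ∸ 1) → Subset k) (U : Fin k → Subset d) where
  open Construction A j π

  δ : Fin m → Fin d → ℕ
  δ ℓ r = b2n (lookup (D ℓ) r xor lookup (unionOver U (S ℓ)) r)

  Δ : Fin m → ℕ
  Δ ℓ = ∑[ r < d ] δ ℓ r

  after : Fin m → Fin m → ℕ
  after ℓ ℓ′ = ⟦ toℕ ℓ ≤? toℕ ℓ′ ⟧

  agree-from : ∀ ℓ r → ∑[ ℓ′ < m ] (after ℓ ℓ′ * δ ℓ′ r) ≡ 0 → RowAnalysis.AgreeFrom A j π U r (toℕ ℓ)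
  agree-from ℓ r total ℓ′ ℓ≤ℓ′ = b2n-xor≡0 (n≤0⇒n≡0 (begin
    δ ℓ′ r                            ≡⟨ sym (*-identityˡ _) ⟩
    1 * δ ℓ′ r                        ≡⟨ cong (_* δ ℓ′ r) (sym (⟦⟧-yes (toℕ ℓ ≤? toℕ ℓ′) ℓ≤ℓ′)) ⟩
    after ℓ ℓ′ * δ ℓ′ r               ≤⟨ term≤∑ (λ ℓ″ → after ℓ ℓ″ * δ ℓ″ r) ℓ′ ⟩
    ∑[ ℓ″ < m ] (after ℓ ℓ″ * δ ℓ″ r) ≡⟨ total ⟩
    0                                 ∎))
    where open ≤-Reasoning

  -- A row where some representative from position ℓ on errs costs at least 1 on the right;
  -- otherwise the stability lemma makes the two sides agree.
  row-error : ∀ ℓ r → b2n (lookup (unionOver U (S ℓ)) r xor lookup (unionOver B (S ℓ)) r)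
                      ≤ ∑[ ℓ′ < m ] (after ℓ ℓ′ * δ ℓ′ r)
  row-error ℓ r with ∑[ ℓ′ < m ] (after ℓ ℓ′ * δ ℓ′ r) in total
  ... | suc _ = ≤-trans (b2n≤1 _) (s≤s z≤n)
  ... | zero rewrite RowAnalysis.stability A j π U r ℓ (agree-from ℓ r total)
                   | xor-same (lookup (unionOver U (S ℓ)) r) = z≤n

  center-error : ∀ ℓ → dist (unionOver U (S ℓ)) (unionOver B (S ℓ)) ≤ ∑[ ℓ′ < m ] (after ℓ ℓ′ * Δ ℓ′)
  center-error ℓ = begin
    dist (unionOver U (S ℓ)) (unionOver B (S ℓ))    ≤⟨ ∑-mono (row-error ℓ) ⟩
    ∑[ r < d ] ∑[ ℓ′ < m ] (after ℓ ℓ′ * δ ℓ′ r)     ≡⟨ ∑-comm (λ r ℓ′ → after ℓ ℓ′ * δ ℓ′ r) ⟩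
    ∑[ ℓ′ < m ] ∑[ r < d ] (after ℓ ℓ′ * δ ℓ′ r)     ≡⟨ sum-cong-≗ (λ ℓ′ → sym (*-distribˡ-sum (after ℓ ℓ′) (δ ℓ′))) ⟩
    ∑[ ℓ′ < m ] (after ℓ ℓ′ * Δ ℓ′)                  ∎
    where open ≤-Reasoning

  module _ (T : Fin n → Subset k) where

    w : Fin n → ℕ
    w j′ = dist (col A j′) (unionOver U (T j′))

    I : Fin n → Fin m → ℕ
    I j′ ℓ = ⟦ S ℓ ≟ₛ T j′ ⟧

    charge : Fin n → Fin m → ℕ
    charge j′ ℓ′ = ∑[ ℓ < m ] (I j′ ℓ * after ℓ ℓ′)

    -- Triangle inequality through the center of T_j′, which is S_ℓ for some ℓ when nonempty.
    column-error : (∀ S′ → Nonempty S′ → ∃ λ ℓ → S ℓ ≡ S′) → ∀ j′ →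
      dist (col A j′) (unionOver B (T j′)) ≤ w j′ + ∑[ ℓ′ < m ] (charge j′ ℓ′ * Δ ℓ′)
    column-error onto j′ =
      ≤-trans (dist-triangle (col A j′) (unionOver U (T j′)) (unionOver B (T j′)))
              (+-monoʳ-≤ (w j′) reconstruction)
      where
      reconstruction : dist (unionOver U (T j′)) (unionOver B (T j′)) ≤ ∑[ ℓ′ < m ] (charge j′ ℓ′ * Δ ℓ′)
      reconstruction with nonempty? (T j′)
      ... | no empty = ≤-trans (≤-reflexive (trans (sum-cong-≗ λ r → cong b2n (cong₂ _xor_
                               (unionOver-false⁺ U (T j′) r λ i i∈ → contradiction (i , i∈) empty)
                               (unionOver-false⁺ B (T j′) r λ i i∈ → contradiction (i , i∈) empty)))
                             (trans (∑-const d 0) (*-zeroʳ d)))) z≤n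
      ... | yes nonempty with onto (T j′) nonempty
      ...   | ℓ , Sℓ≡Tj′ = subst (λ X → dist (unionOver U X) (unionOver B X) ≤ ∑[ ℓ′ < m ] (charge j′ ℓ′ * Δ ℓ′)) Sℓ≡Tj′
                (≤-trans (center-error ℓ) (∑-mono λ ℓ′ → *-monoˡ-≤ (Δ ℓ′) (after≤charge ℓ′)))
        where
        after≤charge : ∀ ℓ′ → after ℓ ℓ′ ≤ charge j′ ℓ′
        after≤charge ℓ′ = begin
          after ℓ ℓ′              ≡⟨ sym (*-identityˡ _) ⟩
          1 * after ℓ ℓ′          ≡⟨ cong (_* after ℓ ℓ′) (sym (⟦⟧-yes (S ℓ ≟ₛ T j′) Sℓ≡Tj′)) ⟩
          I j′ ℓ * after ℓ ℓ′     ≤⟨ term≤∑ (λ ℓ″ → I j′ ℓ″ * after ℓ″ ℓ′) ℓ ⟩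
          charge j′ ℓ′            ∎
          where open ≤-Reasoning

-- Columns j carry weights w_j and positions ℓ ∈ [m] carry costs Δ_ℓ. The
-- 0/1 matrix I assigns each column to at most one position, never to a position costlier
-- than itself, and the loads Σ_j I_jℓ are nondecreasing in ℓ. Then charging every column
-- the costs of all positions from its own on costs at most m · Σ_j w_j: a position ℓ′ is
-- charged by the columns of at most m positions ℓ ≤ ℓ′, each carrying at most its load.
charging : ∀ {n m} (I : Fin n → Fin m → ℕ) (Δ : Fin m → ℕ) (w : Fin n → ℕ) →
  (∀ j → ∑[ ℓ < m ] I j ℓ ≤ 1) →
  (∀ j ℓ → I j ℓ * Δ ℓ ≤ I j ℓ * w j) →
  (∀ ℓ ℓ′ → toℕ ℓ ≤ toℕ ℓ′ → ∑[ j < n ] I j ℓ ≤ ∑[ j < n ] I j ℓ′) →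
  ∑[ j < n ] ∑[ ℓ′ < m ] ((∑[ ℓ < m ] (I j ℓ * ⟦ toℕ ℓ ≤? toℕ ℓ′ ⟧)) * Δ ℓ′) ≤ m * ∑[ j < n ] w j
charging {n} {m} I Δ w at-most-one cheaper sorted = begin
  ∑[ j < n ] ∑[ ℓ′ < m ] (charge j ℓ′ * Δ ℓ′)      ≡⟨ ∑-comm (λ j ℓ′ → charge j ℓ′ * Δ ℓ′) ⟩
  ∑[ ℓ′ < m ] ∑[ j < n ] (charge j ℓ′ * Δ ℓ′)      ≡⟨ sum-cong-≗ (λ ℓ′ → sym (*-distribʳ-sum (Δ ℓ′) (λ j → charge j ℓ′))) ⟩
  ∑[ ℓ′ < m ] (∑[ j < n ] charge j ℓ′ * Δ ℓ′)      ≤⟨ ∑-mono (λ ℓ′ → *-monoˡ-≤ (Δ ℓ′) (charged≤ ℓ′)) ⟩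
  ∑[ ℓ′ < m ] (m * load ℓ′ * Δ ℓ′)                ≡⟨ sum-cong-≗ (λ ℓ′ → *-assoc m (load ℓ′) (Δ ℓ′)) ⟩
  ∑[ ℓ′ < m ] (m * (load ℓ′ * Δ ℓ′))              ≡⟨ sym (*-distribˡ-sum m (λ ℓ′ → load ℓ′ * Δ ℓ′)) ⟩
  m * ∑[ ℓ′ < m ] (load ℓ′ * Δ ℓ′)                ≤⟨ *-monoʳ-≤ m (∑-mono load-cost) ⟩
  m * ∑[ ℓ′ < m ] ∑[ j < n ] (I j ℓ′ * w j)       ≤⟨ *-monoʳ-≤ m assigned-once ⟩
  m * ∑[ j < n ] w j                              ∎
  where
  open ≤-Reasoning
  after : Fin m → Fin m → ℕ
  after ℓ ℓ′ = ⟦ toℕ ℓ ≤? toℕ ℓ′ ⟧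
  charge : Fin n → Fin m → ℕ
  charge j ℓ′ = ∑[ ℓ < m ] (I j ℓ * after ℓ ℓ′)
  load : Fin m → ℕ
  load ℓ = ∑[ j < n ] I j ℓ

  charged≤ : ∀ ℓ′ → ∑[ j < n ] charge j ℓ′ ≤ m * load ℓ′
  charged≤ ℓ′ = begin
    ∑[ j < n ] ∑[ ℓ < m ] (I j ℓ * after ℓ ℓ′)   ≡⟨ ∑-comm (λ j ℓ → I j ℓ * after ℓ ℓ′) ⟩
    ∑[ ℓ < m ] ∑[ j < n ] (I j ℓ * after ℓ ℓ′)   ≡⟨ sum-cong-≗ (λ ℓ → sym (*-distribʳ-sum (after ℓ ℓ′) (λ j → I j ℓ))) ⟩
    ∑[ ℓ < m ] (load ℓ * after ℓ ℓ′)            ≤⟨ ∑-mono load-before ⟩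
    ∑[ ℓ < m ] load ℓ′                          ≡⟨ ∑-const m (load ℓ′) ⟩
    m * load ℓ′                                 ∎
    where
    load-before : ∀ ℓ → load ℓ * after ℓ ℓ′ ≤ load ℓ′
    load-before ℓ with toℕ ℓ ≤? toℕ ℓ′
    ... | yes ℓ≤ℓ′ = ≤-trans (≤-reflexive (*-identityʳ (load ℓ))) (sorted ℓ ℓ′ ℓ≤ℓ′)
    ... | no  _    = ≤-trans (≤-reflexive (*-zeroʳ (load ℓ))) z≤n

  load-cost : ∀ ℓ → load ℓ * Δ ℓ ≤ ∑[ j < n ] (I j ℓ * w j)
  load-cost ℓ = ≤-trans (≤-reflexive (*-distribʳ-sum (Δ ℓ) (λ j → I j ℓ)))
                        (∑-mono λ j → cheaper j ℓ)

  assigned-once : ∑[ ℓ < m ] ∑[ j < n ] (I j ℓ * w j) ≤ ∑[ j < n ] w j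
  assigned-once = begin
    ∑[ ℓ < m ] ∑[ j < n ] (I j ℓ * w j)   ≡⟨ ∑-comm (λ ℓ j → I j ℓ * w j) ⟩
    ∑[ j < n ] ∑[ ℓ < m ] (I j ℓ * w j)   ≡⟨ sum-cong-≗ (λ j → sym (*-distribʳ-sum (w j) (I j))) ⟩
    ∑[ j < n ] (∑[ ℓ < m ] I j ℓ * w j)   ≤⟨ ∑-mono (λ j → *-monoˡ-≤ (w j) (at-most-one j)) ⟩
    ∑[ j < n ] (1 * w j)                  ≡⟨ sum-cong-≗ (λ j → *-identityˡ (w j)) ⟩
    ∑[ j < n ] w j                        ∎

2^k≡1+m : ∀ k → 2 ^ k ≡ suc (2 ^ k ∸ 1)
2^k≡1+m k = sym (trans (+-comm 1 (2 ^ k ∸ 1)) (m∸n+n≡m (m^n>0 2 k)))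

construction-bound : ∀ {d n k} (A : BMat d n) (j : Fin (2 ^ k ∸ 1) → Fin n) (π : Fin (2 ^ k ∸ 1) → Subset k)
  (U : Fin k → Subset d) (T : Fin n → Subset k) → IsBijToNonempty π →
  (∀ ℓ j′ → π ℓ ≡ T j′ → dist (col A (j ℓ)) (unionOver U (π ℓ)) ≤ dist (col A j′) (unionOver U (T j′))) →
  (∀ ℓ ℓ′ → toℕ ℓ ≤ toℕ ℓ′ → ∑[ j′ < n ] ⟦ π ℓ ≟ₛ T j′ ⟧ ≤ ∑[ j′ < n ] ⟦ π ℓ′ ≟ₛ T j′ ⟧) →
  Err A (constructB A j π) ≤ 2 ^ k * Cost A U T
construction-bound {d} {n} {k} A j π U T (injective , _ , onto) closest sorted = begin
  Err A B                                                                ≤⟨ Err≤ A B T ⟩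
  ∑[ j′ < n ] dist (col A j′) (unionOver B (T j′))                       ≤⟨ ∑-mono (column-error T onto) ⟩
  ∑[ j′ < n ] (w T j′ + ∑[ ℓ′ < m ] (charge T j′ ℓ′ * Δ ℓ′))             ≡⟨ ∑-distrib-+ (w T) _ ⟩
  ∑[ j′ < n ] w T j′ + ∑[ j′ < n ] ∑[ ℓ′ < m ] (charge T j′ ℓ′ * Δ ℓ′)   ≤⟨ +-monoʳ-≤ _ charged ⟩
  ∑[ j′ < n ] w T j′ + m * ∑[ j′ < n ] w T j′                            ≡⟨ cong (_* ∑[ j′ < n ] w T j′) (2^k≡1+m k) ⟨
  2 ^ k * ∑[ j′ < n ] w T j′                                             ∎
  where
  open ≤-Reasoning
  open Construction A j π using (m; B)
  open ColumnAnalysis A j π U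
  charged : ∑[ j′ < n ] ∑[ ℓ′ < m ] (charge T j′ ℓ′ * Δ ℓ′) ≤ m * ∑[ j′ < n ] w T j′
  charged = charging (I T) Δ (w T) at-most-one cheaper sorted
    where
    at-most-one : ∀ j′ → ∑[ ℓ < m ] I T j′ ℓ ≤ 1
    at-most-one j′ = ∑≤1 (I T j′) (λ ℓ → ⟦⟧≤1 (π ℓ ≟ₛ T j′)) λ ℓ ℓ′ p q →
      injective (trans (⟦⟧-pos (π ℓ ≟ₛ T j′) p) (sym (⟦⟧-pos (π ℓ′ ≟ₛ T j′) q)))
    cheaper : ∀ j′ ℓ → I T j′ ℓ * Δ ℓ ≤ I T j′ ℓ * w T j′
    cheaper j′ ℓ with π ℓ ≟ₛ T j′
    ... | yes πℓ≡Tj′ = +-monoˡ-≤ 0 (closest ℓ j′ πℓ≡Tj′)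
    ... | no  _      = z≤n

HasArgmin : Set → Set
HasArgmin X = (f : X → ℕ) → ∃ λ x → ∀ y → f x ≤ f y

argmin-Bool : HasArgmin Bool
argmin-Bool f with ≤-total (f true) (f false)
... | inj₁ t≤f = true  , λ { true → ≤-refl ; false → t≤f }
... | inj₂ f≤t = false , λ { true → f≤t    ; false → ≤-refl }

argmin-Fin : ∀ n → HasArgmin (Fin (suc n))
argmin-Fin zero    f = zero , λ { zero → ≤-refl }
argmin-Fin (suc n) f with argmin-Fin n (f ∘ suc)
... | x , min with ≤-total (f zero) (f (suc x))
...   | inj₁ f₀≤ = zero  , λ { zero → ≤-refl ; (suc y) → ≤-trans f₀≤ (min y) }
...   | inj₂ ≤f₀ = suc x , λ { zero → ≤f₀   ; (suc y) → min y }

-- Minimise coordinatewise: first the head for each fixed tail, then the tail.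
argmin-× : ∀ {X Y} → HasArgmin X → HasArgmin Y → HasArgmin (X × Y)
argmin-× {X} {Y} argmin-X argmin-Y f = (best-x (proj₁ best-y) , proj₁ best-y) , λ { (x , y) →
    ≤-trans (proj₂ best-y y) (proj₂ (argmin-X (λ x → f (x , y))) x) }
  where
  best-x : Y → X
  best-x y = proj₁ (argmin-X (λ x → f (x , y)))
  best-y = argmin-Y (λ y → f (best-x y , y))

argmin-Vec : ∀ {X} → HasArgmin X → ∀ n → HasArgmin (Vec.Vec X n)
argmin-Vec argmin-X zero    f = [] , λ { [] → ≤-refl }
argmin-Vec argmin-X (suc n) f with argmin-× argmin-X (argmin-Vec argmin-X n) (λ (x , xs) → f (x ∷ xs))
... | (x , xs) , min = x ∷ xs , λ { (y ∷ ys) → min (y , ys) }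

-- A subset s of [k] read as a k-bit number, least significant bit first.
value : ∀ {k} → Subset k → ℕ
value []      = 0
value (b ∷ s) = b2n b + 2 * value s

parity : ℕ → Bool
parity zero          = false
parity (suc zero)    = true
parity (suc (suc x)) = parity x

half : ℕ → ℕ
half zero          = 0
half (suc zero)    = 0
half (suc (suc x)) = suc (half x)

bits : ∀ k → ℕ → Subset k
bits zero    x = []
bits (suc k) x = parity x ∷ bits k (half x)

digit-suc : ∀ b y → b2n b + 2 * suc y ≡ suc (suc (b2n b + 2 * y))
digit-suc b y = trans (cong (b2n b +_) (*-suc 2 y))
                      (trans (+-suc (b2n b) (suc (2 * y))) (cong suc (+-suc (b2n b) (2 * y))))

parity-half : ∀ x → b2n (parity x) + 2 * half x ≡ x
parity-half zero          = refl
parity-half (suc zero)    = refl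
parity-half (suc (suc x)) = trans (digit-suc (parity x) (half x)) (cong (λ y → suc (suc y)) (parity-half x))

parity-digit : ∀ b y → parity (b2n b + 2 * y) ≡ b
parity-digit true  zero    = refl
parity-digit false zero    = refl
parity-digit b     (suc y) rewrite digit-suc b y = parity-digit b y

half-digit : ∀ b y → half (b2n b + 2 * y) ≡ y
half-digit true  zero    = refl
half-digit false zero    = refl
half-digit b     (suc y) rewrite digit-suc b y = cong suc (half-digit b y)

bits-value : ∀ {k} (s : Subset k) → bits k (value s) ≡ s
bits-value []      = refl
bits-value (b ∷ s) rewrite parity-digit b (value s) | half-digit b (value s) = cong (b ∷_) (bits-value s)

value-bits : ∀ k x → x < 2 ^ k → value (bits k x) ≡ x
value-bits zero    zero    _  = refl
value-bits zero    (suc x) (s≤s ())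
value-bits (suc k) x       x< = trans (cong (λ v → b2n (parity x) + 2 * v) (value-bits k (half x) half<))
                                      (parity-half x)
  where
  half< : half x < 2 ^ k
  half< = *-cancelˡ-< 2 (half x) (2 ^ k)
            (≤-<-trans (≤-trans (m≤n+m _ (b2n (parity x))) (≤-reflexive (parity-half x))) x<)

value< : ∀ {k} (s : Subset k) → value s < 2 ^ k
value< []          = s≤s z≤n
value< {suc k} (b ∷ s) = begin-strict
  b2n b + 2 * value s   <⟨ +-monoˡ-< (2 * value s) (s≤s (b2n≤1 b)) ⟩
  2 + 2 * value s       ≡⟨ sym (*-suc 2 (value s)) ⟩
  2 * suc (value s)     ≤⟨ *-monoʳ-≤ 2 (value< s) ⟩
  2 * 2 ^ k             ∎
  where open ≤-Reasoning

value-nonempty : ∀ {k} (s : Subset k) → Nonempty s → 1 ≤ value s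
value-nonempty (true ∷ s) (zero , Vec.here) = s≤s z≤n
value-nonempty (b ∷ s) (suc x , Vec.there x∈s) =
  ≤-trans (≤-trans (value-nonempty s (x , x∈s)) (m≤n*m (value s) 2)) (m≤n+m (2 * value s) (b2n b))

value-⊥ : ∀ k → value (⊥ {k}) ≡ 0
value-⊥ zero    = refl
value-⊥ (suc k) = cong (2 *_) (value-⊥ k)

code : ∀ k → Fin (2 ^ k ∸ 1) → Subset k
code k ℓ = bits k (suc (toℕ ℓ))

code-bijective : ∀ k → IsBijToNonempty (code k)
code-bijective k = injective , nonempty , onto
  where
  code< : ∀ ℓ → suc (toℕ ℓ) < 2 ^ k
  code< ℓ = subst (suc (toℕ ℓ) <_) (sym (2^k≡1+m k)) (s≤s (Fin.toℕ<n ℓ))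
  value-code : ∀ ℓ → value (code k ℓ) ≡ suc (toℕ ℓ)
  value-code ℓ = value-bits k (suc (toℕ ℓ)) (code< ℓ)

  injective : ∀ {ℓ ℓ′} → code k ℓ ≡ code k ℓ′ → ℓ ≡ ℓ′
  injective {ℓ} {ℓ′} e = Fin.toℕ-injective (suc-injective
    (trans (sym (value-code ℓ)) (trans (cong value e) (value-code ℓ′))))

  nonempty : ∀ ℓ → Nonempty (code k ℓ)
  nonempty ℓ with nonempty? (code k ℓ)
  ... | yes ne    = ne
  ... | no  empty = contradiction (trans (sym (value-code ℓ))
                                    (trans (cong value (Empty-unique empty)) (value-⊥ k))) λ ()

  onto : ∀ s → Nonempty s → ∃ λ ℓ → code k ℓ ≡ s
  onto s ne = fromℕ< ℓ< , trans (cong (bits k ∘ suc) (Fin.toℕ-fromℕ< ℓ<))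
                                (trans (cong (bits k) value≡suc) (bits-value s))
    where
    value≡suc : suc (pred (value s)) ≡ value s
    value≡suc = suc-pred (value s) {{>-nonZero (value-nonempty s ne)}}
    ℓ< : pred (value s) < 2 ^ k ∸ 1
    ℓ< = ≤-pred (subst₂ _<_ (sym value≡suc) (2^k≡1+m k) (value< s))

-- An optimal solution exists: minimise over the (finitely many) vectors of subsets.
optimal-solution : ∀ {d n k} (A : BMat d n) →
  ∃ λ ((U , T) : (Fin k → Subset d) × (Fin n → Subset k)) → ∀ U′ T′ → Cost A U T ≤ Cost A U′ T′
optimal-solution {d} {n} {k} A with argmin-× (subsets k) (subsets n) (λ (Us , Ts) → Cost A (lookup Us) (lookup Ts))
  where
  subsets : ∀ l {c} → HasArgmin (Vec.Vec (Subset c) l)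
  subsets l {c} = argmin-Vec (argmin-Vec argmin-Bool c) l
... | (Us , Ts) , min = (lookup Us , lookup Ts) , λ U′ T′ →
  subst (Cost A (lookup Us) (lookup Ts) ≤_)
        (Cost-cong A (lookup∘tabulate U′) (lookup∘tabulate T′))
        (min (Vec.tabulate U′ , Vec.tabulate T′))

sorting : ∀ m (w : Fin m → ℕ) →
  Σ (Permutation m m) λ σ → ∀ a b → toℕ a ≤ toℕ b → w (σ ⟨$⟩ʳ a) ≤ w (σ ⟨$⟩ʳ b)
sorting zero    w = Perm.id , λ ()
sorting (suc m) w with argmin-Fin m w
... | lightest , min = σ , sorted
  where
  τ : Permutation (suc m) (suc m)
  τ = transpose zero lightest
  rest = sorting m (λ x → w (τ ⟨$⟩ʳ suc x))
  σ : Permutation (suc m) (suc m)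
  σ = lift₀ (proj₁ rest) ∘ₚ τ
  sorted : ∀ a b → toℕ a ≤ toℕ b → w (σ ⟨$⟩ʳ a) ≤ w (σ ⟨$⟩ʳ b)
  sorted zero    b       _         = min (σ ⟨$⟩ʳ b)
  sorted (suc a) (suc b) (s≤s a≤b) = proj₂ rest a b a≤b

IsBijToNonempty-∘ : ∀ {k} {π : Fin (2 ^ k ∸ 1) → Subset k} (σ : Permutation (2 ^ k ∸ 1) (2 ^ k ∸ 1)) →
                    IsBijToNonempty π → IsBijToNonempty (π ∘ (σ ⟨$⟩ʳ_))
IsBijToNonempty-∘ {π = π} σ (injective , nonempty , onto) =
  (λ e → trans (sym (inverseˡ σ)) (trans (cong (σ ⟨$⟩ˡ_) (injective e)) (inverseˡ σ))) ,
  (λ ℓ → nonempty (σ ⟨$⟩ʳ ℓ)) ,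
  (λ S ne → let (ℓ , πℓ≡S) = onto S ne in σ ⟨$⟩ˡ ℓ , trans (cong π (inverseʳ σ)) πℓ≡S)

theorem4 : (d n k : ℕ) → 1 ≤ k → 1 ≤ n → (A : BMat d n) →
    ∃[ j ] ∃[ π ] (IsBijToNonempty {k} π ×
    ((U : BMat d k) (V : BMat k n) →
    Err A (constructB A j π) ≤ 2 ^ k * dist² A (U ⊙ V)))
theorem4 d (suc n′) k _ _ A = j , π , IsBijToNonempty-∘ σ (code-bijective k) , bound
  where
  optimum = optimal-solution {k = k} A
  U = proj₁ (proj₁ optimum)
  T = proj₂ (proj₁ optimum)
  load : Fin (2 ^ k ∸ 1) → ℕ
  load ℓ = ∑[ j′ < suc n′ ] ⟦ code k ℓ ≟ₛ T j′ ⟧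
  σ = proj₁ (sorting _ load)
  π : Fin (2 ^ k ∸ 1) → Subset k
  π ℓ = code k (σ ⟨$⟩ʳ ℓ)
  closest = λ ℓ → argmin-Fin n′ (λ j′ → dist (col A j′) (unionOver U (π ℓ)))
  j : Fin (2 ^ k ∸ 1) → Fin (suc n′)
  j ℓ = proj₁ (closest ℓ)
  bound : (U′ : BMat d k) (V′ : BMat k (suc n′)) → Err A (constructB A j π) ≤ 2 ^ k * dist² A (U′ ⊙ V′)
  bound U′ V′ = begin
    Err A (constructB A j π)       ≤⟨ construction-bound A j π U T (IsBijToNonempty-∘ σ (code-bijective k))
                                        (λ ℓ j′ e → subst (λ X → _ ≤ dist (col A j′) (unionOver U X)) e
                                                          (proj₂ (closest ℓ) j′))
                                        (λ ℓ ℓ′ → proj₂ (sorting _ load) ℓ ℓ′) ⟩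
    2 ^ k * Cost A U T             ≤⟨ *-monoʳ-≤ (2 ^ k) (proj₂ optimum (col U′) (col V′)) ⟩
    2 ^ k * Cost A (col U′) (col V′) ≡⟨ cong (2 ^ k *_) (dist²-⊙ A U′ V′) ⟨
    2 ^ k * dist² A (U′ ⊙ V′)      ∎
    where open ≤-Reasoning
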